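{- Let $n$ and $k$ be positive integers. Consider the multiset of products of distinct odd integers $$\Pi_n=\{x_1x_2\dotsb x_t : t\ge0,\ 1\le x_1<\dotsb<x_t\le n,\ x_j \text{ odd for } 1\le j\le t\},$$ where the empty product ($t=0$), equal to $1$, is included, so that $\Pi_n$ has $2^{\lfloor n/2\rfloor}$ elements. For $i=1,3,5,\dots,2^k-1$, let $m_i$ be the number of elements of $\Pi_n$ (counted with multiplicity) that are congruent to $i$ modulo $2^k$. If $n\ge 2^{k-1}+2$, then all the numbers $m_i$ are equal. -}

module Defs where

open import Data.Nat using (ℕ; zero; suc; _*_; _^_; _%_)
open import Data.Nat.Properties using (_≟_; m^n≢0)
open import Data.List using (List; []; _∷_; _++_; map; filter; length)
open import Data.Bool using (if_then_else_)
open import Relation.Nullary.Decidable using (does)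

isOdd : ℕ → Data.Bool.Bool
isOdd n = does ((n % 2) ≟ 1)

Π : ℕ → List ℕ
Π zero = 1 ∷ []
Π (suc n) = if isOdd (suc n) then Π n ++ map (suc n *_) (Π n) else Π n

m : ℕ → ℕ → ℕ → ℕ
m n k i = let instance _ = m^n≢0 2 k in length (filter (λ x → (x % (2 ^ k)) ≟ (i % (2 ^ k))) (Π n))

-- Having equally many
-- elements in every odd residue class mod 2^k is preserved by concatenation and by
-- multiplication with an odd number (a unit mod 2^k), so it passes from Π n to Π (n + 1).
-- It therefore suffices to reach it at n = h + 1 with h = 2^(k-1), by induction on k:
-- Π (h + 1) = Π h ++ (1 + h)·Π h, and (1 + h) y ≡ y + h (mod 2h) for odd y, so the class
-- of i mod 2h in Π (h + 1) gathers the classes of i and i + h mod 2h in Π h, i.e. the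
-- class of i mod h in Π h, which is equidistributed by induction and the first remark.
module Submission where

open import Defs
open import Level using (Level)
open import Data.Nat using (ℕ; zero; suc; _+_; _*_; _^_; _∸_; _≤_; _<_; _≤′_; ≤′-refl; ≤′-step; _%_; _/_; NonZero)
open import Data.Nat.Properties
open import Data.Nat.DivMod
open import Data.Nat.Divisibility using (_∣_; ∣-trans; ∣1⇒≡1; m∣m*n; n∣m*n; n∣m⇒m%n≡0)
open import Data.Nat.Coprimality using (Coprime; coprime-Bézout; coprime-divisor)
open import Data.Nat.GCD using (module Bézout)
open import Data.Nat.Primality using (irreducible[2])
open import Data.Nat.Tactic.RingSolver using (solve-∀)
open import Data.Bool using (if_then_else_)
open import Data.List using (List; []; _∷_; _++_; map; filter; length)
open import Data.List.Properties using (length-++; filter-++; filter-≐)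
open import Data.List.Relation.Unary.All as All using (All; []; _∷_)
open import Data.List.Relation.Unary.All.Properties using (++⁺; map⁺)
open import Data.Product using (∃-syntax; _×_; _,_; proj₁; proj₂)
open import Data.Sum using (inj₁; inj₂)
open import Function using (id; _∘_; _⇔_; mk⇔; Equivalence)
open import Relation.Nullary using (¬_; yes; no; contradiction)
open import Relation.Nullary.Decidable using (dec-true; dec-false)
open import Relation.Unary using (Pred; Decidable; _≐_)
open import Relation.Unary.Properties using (_∩?_; ∁?)
open import Relation.Binary.PropositionalEquality using (_≡_; _≢_; refl; sym; trans; cong; cong₂; subst; module ≡-Reasoning)

open ≡-Reasoning

private
  variable
    a b ℓ ℓ′ : Level
    A : Set a
    B : Set b

count : {P : Pred A ℓ} → Decidable P → List A → ℕ
count P? = length ∘ filter P?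

count-++ : {P : Pred A ℓ} (P? : Decidable P) (xs ys : List A) →
           count P? (xs ++ ys) ≡ count P? xs + count P? ys
count-++ P? xs ys = trans (cong length (filter-++ P? xs ys)) (length-++ (filter P? xs))

count-≐ : {P : Pred A ℓ} {Q : Pred A ℓ′} (P? : Decidable P) (Q? : Decidable Q) →
          P ≐ Q → (xs : List A) → count P? xs ≡ count Q? xs
count-≐ P? Q? P≐Q xs = cong length (filter-≐ P? Q? P≐Q xs)

count-∩-∁ : {P : Pred A ℓ} {Q : Pred A ℓ′} (P? : Decidable P) (Q? : Decidable Q) (xs : List A) →
            count P? xs ≡ count (P? ∩? Q?) xs + count (P? ∩? ∁? Q?) xs
count-∩-∁ P? Q? [] = refl
count-∩-∁ P? Q? (x ∷ xs) with P? x | Q? x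
... | yes _ | yes _ = cong suc (count-∩-∁ P? Q? xs)
... | yes _ | no _  = trans (cong suc (count-∩-∁ P? Q? xs)) (sym (+-suc _ _))
... | no _  | _     = count-∩-∁ P? Q? xs

count-map : {P : Pred B ℓ} {Q : Pred A ℓ′} (P? : Decidable P) (Q? : Decidable Q) (f : A → B) {xs : List A} →
            All (λ x → P (f x) ⇔ Q x) xs → count P? (map f xs) ≡ count Q? xs
count-map P? Q? f [] = refl
count-map P? Q? f {x ∷ xs} (P⇔Q ∷ P⇔Qs) with P? (f x) | Q? x
... | yes _   | yes _  = cong suc (count-map P? Q? f P⇔Qs)
... | no _    | no _   = count-map P? Q? f P⇔Qs
... | yes Pfx | no ¬Qx = contradiction (Equivalence.to P⇔Q Pfx) ¬Qx
... | no ¬Pfx | yes Qx = contradiction (Equivalence.from P⇔Q Qx) ¬Pfx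

Odd : ℕ → Set
Odd x = x % 2 ≡ 1

suc-%2-≢ : ∀ x → suc x % 2 ≢ x % 2
suc-%2-≢ zero ()
suc-%2-≢ (suc zero) ()
suc-%2-≢ (suc (suc x)) = suc-%2-≢ x

%2-≢⇒≡suc : ∀ x y → x % 2 ≢ y % 2 → x % 2 ≡ suc y % 2
%2-≢⇒≡suc (suc (suc x)) y           = %2-≢⇒≡suc x y
%2-≢⇒≡suc x             (suc (suc y)) = %2-≢⇒≡suc x y
%2-≢⇒≡suc 0 0 x≢y = contradiction refl x≢y
%2-≢⇒≡suc 0 1 _   = refl
%2-≢⇒≡suc 1 0 _   = refl
%2-≢⇒≡suc 1 1 x≢y = contradiction refl x≢y

odd-* : ∀ {x y} → Odd x → Odd y → Odd (x * y)
odd-* {x} {y} odd-x odd-y = trans (%-distribˡ-* x y 2) (cong₂ (λ r s → (r * s) % 2) odd-x odd-y)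

odd-*⇒oddʳ : ∀ {x y} → Odd (x * y) → Odd y
odd-*⇒oddʳ {x} {y} odd-xy = %2-≢⇒≡suc y 0 λ y-even → 0≢1+n (begin
  0                      ≡⟨ cong (_% 2) (*-zeroʳ (x % 2)) ⟨
  (x % 2 * 0) % 2        ≡⟨ cong (λ r → (x % 2 * r) % 2) y-even ⟨
  (x % 2 * (y % 2)) % 2  ≡⟨ %-distribˡ-* x y 2 ⟨
  (x * y) % 2            ≡⟨ odd-xy ⟩
  1                      ∎)

odd⇒¬2∣ : ∀ {x} → Odd x → ¬ 2 ∣ x
odd⇒¬2∣ {x} odd-x 2∣x = 0≢1+n (trans (sym (n∣m⇒m%n≡0 x 2 2∣x)) odd-x)

module _ {n : ℕ} .{{_ : NonZero n}} where

  %-cong-∣ : ∀ {d x y} .{{_ : NonZero d}} → d ∣ n → x % n ≡ y % n → x % d ≡ y % d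
  %-cong-∣ {d} {x} {y} d∣n x≡y = begin
    x % d      ≡⟨ m∣n⇒o%n%m≡o%m d n x d∣n ⟨
    x % n % d  ≡⟨ cong (_% d) x≡y ⟩
    y % n % d  ≡⟨ m∣n⇒o%n%m≡o%m d n y d∣n ⟩
    y % d      ∎

  %-cong-+ʳ : ∀ {x y} z → x % n ≡ y % n → (x + z) % n ≡ (y + z) % n
  %-cong-+ʳ {x} {y} z x≡y = begin
    (x + z) % n            ≡⟨ %-distribˡ-+ x z n ⟩
    (x % n + z % n) % n    ≡⟨ cong (λ r → (r + z % n) % n) x≡y ⟩
    (y % n + z % n) % n    ≡⟨ %-distribˡ-+ y z n ⟨
    (y + z) % n            ∎

  %-cong-*ˡ : ∀ z {x y} → x % n ≡ y % n → (z * x) % n ≡ (z * y) % n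
  %-cong-*ˡ z {x} {y} x≡y = begin
    (z * x) % n            ≡⟨ %-distribˡ-* z x n ⟩
    (z % n * (x % n)) % n  ≡⟨ cong (λ r → (z % n * r) % n) x≡y ⟩
    (z % n * (y % n)) % n  ≡⟨ %-distribˡ-* z y n ⟨
    (z * y) % n            ∎

  %-unit-*ˡ : ∀ {u} x → u % n ≡ 1 % n → (u * x) % n ≡ x % n
  %-unit-*ˡ {u} x u≡1 = begin
    (u * x) % n            ≡⟨ %-distribˡ-* u x n ⟩
    (u % n * (x % n)) % n  ≡⟨ cong (λ r → (r * (x % n)) % n) u≡1 ⟩
    (1 % n * (x % n)) % n  ≡⟨ %-distribˡ-* 1 x n ⟨
    (1 * x) % n            ≡⟨ cong (_% n) (*-identityˡ x) ⟩
    x % n                  ∎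

odd⇒coprime-2 : ∀ {x} → Odd x → Coprime x 2
odd⇒coprime-2 odd-x (d∣x , d∣2) with irreducible[2] d∣2
... | inj₁ d≡1 = d≡1
... | inj₂ refl = contradiction d∣x (odd⇒¬2∣ odd-x)

odd⇒coprime-2^ : ∀ {x} → Odd x → ∀ k → Coprime x (2 ^ k)
odd⇒coprime-2^ odd-x zero    (_ , d∣1) = ∣1⇒≡1 d∣1
odd⇒coprime-2^ odd-x (suc k) {d} (d∣x , d∣2^[1+k]) =
  odd⇒coprime-2^ odd-x k (d∣x , coprime-divisor d⊥2 d∣2^[1+k])
  where
  d⊥2 : Coprime d 2
  d⊥2 (e∣d , e∣2) = odd⇒coprime-2 odd-x (∣-trans e∣d d∣x , e∣2)

coprime⇒invertible : ∀ {x n} .{{_ : NonZero n}} → Coprime x n → ∃[ y ] (x * y) % n ≡ 1 % n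
coprime⇒invertible {x} {n} x⊥n with coprime-Bézout x⊥n
... | Bézout.+- a b 1+bn≡ax = a , (begin
  (x * a) % n      ≡⟨ cong (_% n) (trans (*-comm x a) (sym 1+bn≡ax)) ⟩
  (1 + b * n) % n  ≡⟨ [m+kn]%n≡m%n 1 b n ⟩
  1 % n            ∎)
-- Here a x ≡ -1 (mod n), so (a x)² ≡ 1.
... | Bézout.-+ a b 1+ax≡bn = a * a * x , (begin
  (x * (a * a * x)) % n                ≡⟨ [m+kn]%n≡m%n _ (2 * b) n ⟨
  (x * (a * a * x) + 2 * b * n) % n    ≡⟨ cong (_% n) square ⟩
  (1 + b * b * n * n) % n              ≡⟨ [m+kn]%n≡m%n 1 (b * b * n) n ⟩
  1 % n                                ∎)
  where
  lhs-expand : ∀ x a b n → x * (a * a * x) + 2 * b * n ≡ a * x * (a * x) + 2 * (b * n)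
  lhs-expand = solve-∀
  complete-square : ∀ u → u * u + 2 * (1 + u) ≡ 1 + (1 + u) * (1 + u)
  complete-square = solve-∀
  rearrange : ∀ b n → b * n * (b * n) ≡ b * b * n * n
  rearrange = solve-∀
  square : x * (a * a * x) + 2 * b * n ≡ 1 + b * b * n * n
  square = begin
    x * (a * a * x) + 2 * b * n        ≡⟨ lhs-expand x a b n ⟩
    a * x * (a * x) + 2 * (b * n)      ≡⟨ cong (λ r → a * x * (a * x) + 2 * r) 1+ax≡bn ⟨
    a * x * (a * x) + 2 * (1 + a * x)  ≡⟨ complete-square (a * x) ⟩
    1 + (1 + a * x) * (1 + a * x)      ≡⟨ cong (λ r → 1 + r * r) 1+ax≡bn ⟩
    1 + b * n * (b * n)                ≡⟨ cong suc (rearrange b n) ⟩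
    1 + b * b * n * n                  ∎

countMod : (n : ℕ) .{{_ : NonZero n}} → ℕ → List ℕ → ℕ
countMod n i = count (λ x → x % n ≟ i % n)

module _ {n : ℕ} .{{_ : NonZero n}} where

  countMod-cong : ∀ {i j} → i % n ≡ j % n → ∀ xs → countMod n i xs ≡ countMod n j xs
  countMod-cong i≡j xs = cong (λ r → count (λ x → x % n ≟ r) xs) i≡j

  countMod-map-* : ∀ {x y} → (x * y) % n ≡ 1 % n → ∀ i xs →
                   countMod n i (map (x *_) xs) ≡ countMod n (y * i) xs
  countMod-map-* {x = x} {y = y} xy≡1 i xs = count-map _ _ (x *_) (All.universal (λ z → mk⇔ to from) xs)
    where
    yx≡1 : (y * x) % n ≡ 1 % n
    yx≡1 = trans (cong (_% n) (*-comm y x)) xy≡1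
    to : ∀ {z} → (x * z) % n ≡ i % n → z % n ≡ (y * i) % n
    to {z} xz≡i = begin
      z % n              ≡⟨ %-unit-*ˡ z yx≡1 ⟨
      (y * x * z) % n    ≡⟨ cong (_% n) (*-assoc y x z) ⟩
      (y * (x * z)) % n  ≡⟨ %-cong-*ˡ y xz≡i ⟩
      (y * i) % n        ∎
    from : ∀ {z} → z % n ≡ (y * i) % n → (x * z) % n ≡ i % n
    from {z} z≡yi = begin
      (x * z) % n       ≡⟨ %-cong-*ˡ x z≡yi ⟩
      (x * (y * i)) % n ≡⟨ cong (_% n) (*-assoc x y i) ⟨
      (x * y * i) % n   ≡⟨ %-unit-*ˡ i xy≡1 ⟩
      i % n             ∎

-- Equidistribution of odd residues

Equidistributed : (n : ℕ) .{{_ : NonZero n}} → List ℕ → Set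
Equidistributed n xs = ∀ i j → Odd i → Odd j → countMod n i xs ≡ countMod n j xs

equidistributed-mod-2 : ∀ xs → Equidistributed 2 xs
equidistributed-mod-2 xs i j odd-i odd-j = countMod-cong {i = i} {j} (trans odd-i (sym odd-j)) xs

module _ {n : ℕ} .{{_ : NonZero n}} where

  equidistributed-++ : ∀ {xs ys} → Equidistributed n xs → Equidistributed n ys →
                       Equidistributed n (xs ++ ys)
  equidistributed-++ {xs} {ys} eq-xs eq-ys i j odd-i odd-j = begin
    countMod n i (xs ++ ys)            ≡⟨ count-++ _ xs ys ⟩
    countMod n i xs + countMod n i ys  ≡⟨ cong₂ _+_ (eq-xs i j odd-i odd-j) (eq-ys i j odd-i odd-j) ⟩
    countMod n j xs + countMod n j ys  ≡⟨ count-++ _ xs ys ⟨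
    countMod n j (xs ++ ys)            ∎

  equidistributed-map-* : ∀ {x y xs} → (x * y) % n ≡ 1 % n → Odd y →
                          Equidistributed n xs → Equidistributed n (map (x *_) xs)
  equidistributed-map-* {x} {y} {xs} xy≡1 odd-y eq i j odd-i odd-j = begin
    countMod n i (map (x *_) xs)  ≡⟨ countMod-map-* {x = x} {y = y} xy≡1 i xs ⟩
    countMod n (y * i) xs         ≡⟨ eq (y * i) (y * j) (odd-* {y} odd-y odd-i) (odd-* {y} odd-y odd-j) ⟩
    countMod n (y * j) xs         ≡⟨ countMod-map-* {x = x} {y = y} xy≡1 j xs ⟨
    countMod n j (map (x *_) xs)  ∎

-- Doubling the modulus

module _ {h : ℕ} .{{_ : NonZero h}} where

  private instance
    2h≢0 : NonZero (2 * h)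
    2h≢0 = m*n≢0 2 h

  m%[2*h]≡m%h+[m/h%2]*h : ∀ y → y % (2 * h) ≡ y % h + (y / h % 2) * h
  m%[2*h]≡m%h+[m/h%2]*h y = begin
    y % (2 * h)                              ≡⟨ m≡m%n+[m/n]*n (y % (2 * h)) h ⟩
    y % (2 * h) % h + (y % (2 * h) / h) * h  ≡⟨ cong₂ (λ r s → r + s * h) (m∣n⇒o%n%m≡o%m h (2 * h) y (n∣m*n 2)) (m%[n*o]/o≡m/o%n y 2 h) ⟩
    y % h + (y / h % 2) * h                  ∎

  ≡-mod-2*⇒ : ∀ {y i} → y % (2 * h) ≡ i % (2 * h) → y % h ≡ i % h × y / h % 2 ≡ i / h % 2
  ≡-mod-2*⇒ {y} {i} y≡i = %-cong-∣ {2 * h} {h} (n∣m*n 2) y≡i , (begin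
    y / h % 2            ≡⟨ m%[n*o]/o≡m/o%n y 2 h ⟨
    y % (2 * h) / h      ≡⟨ cong (_/ h) y≡i ⟩
    i % (2 * h) / h      ≡⟨ m%[n*o]/o≡m/o%n i 2 h ⟩
    i / h % 2            ∎)

  ≡-mod-2*⇐ : ∀ {y i} → y % h ≡ i % h → y / h % 2 ≡ i / h % 2 → y % (2 * h) ≡ i % (2 * h)
  ≡-mod-2*⇐ {y} {i} y≡i y/h≡i/h = begin
    y % (2 * h)              ≡⟨ m%[2*h]≡m%h+[m/h%2]*h y ⟩
    y % h + (y / h % 2) * h  ≡⟨ cong₂ (λ r s → r + s * h) y≡i y/h≡i/h ⟩
    i % h + (i / h % 2) * h  ≡⟨ m%[2*h]≡m%h+[m/h%2]*h i ⟨
    i % (2 * h)              ∎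

  [m+h]/h≡1+m/h : ∀ y → (y + h) / h ≡ suc (y / h)
  [m+h]/h≡1+m/h y = begin
    (y + h) / h            ≡⟨ m/n≡1+[m∸n]/n (m≤n+m h y) ⟩
    suc ((y + h ∸ h) / h)  ≡⟨ cong (λ r → suc (r / h)) (m+n∸n≡m y h) ⟩
    suc (y / h)            ∎

  countMod-split : ∀ i xs → countMod h i xs ≡ countMod (2 * h) i xs + countMod (2 * h) (i + h) xs
  countMod-split i xs = begin
    countMod h i xs                                    ≡⟨ count-∩-∁ _ Q? xs ⟩
    count (P? ∩? Q?) xs + count (P? ∩? ∁? Q?) xs       ≡⟨ cong₂ _+_ (count-≐ _ _ P∩Q≐Q xs) (count-≐ _ _ P∖Q≐R xs) ⟩
    countMod (2 * h) i xs + countMod (2 * h) (i + h) xs ∎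
    where
    P? : Decidable (λ y → y % h ≡ i % h)
    P? y = y % h ≟ i % h
    Q? : Decidable (λ y → y % (2 * h) ≡ i % (2 * h))
    Q? y = y % (2 * h) ≟ i % (2 * h)
    i+h≡i : (i + h) % h ≡ i % h
    i+h≡i = [m+n]%n≡m%n i h
    parity-i+h : (i + h) / h % 2 ≡ suc (i / h) % 2
    parity-i+h = cong (_% 2) ([m+h]/h≡1+m/h i)
    P∩Q≐Q : (λ y → y % h ≡ i % h × y % (2 * h) ≡ i % (2 * h)) ≐ (λ y → y % (2 * h) ≡ i % (2 * h))
    P∩Q≐Q = proj₂ , λ y≡i → proj₁ (≡-mod-2*⇒ y≡i) , y≡i
    P∖Q≐R : (λ y → y % h ≡ i % h × ¬ y % (2 * h) ≡ i % (2 * h)) ≐ (λ y → y % (2 * h) ≡ (i + h) % (2 * h))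
    P∖Q≐R = to , from
      where
      to : ∀ {y} → y % h ≡ i % h × ¬ y % (2 * h) ≡ i % (2 * h) → y % (2 * h) ≡ (i + h) % (2 * h)
      to {y} (y≡i , y≢i) = ≡-mod-2*⇐ (trans y≡i (sym i+h≡i))
        (trans (%2-≢⇒≡suc (y / h) (i / h) (y≢i ∘ ≡-mod-2*⇐ y≡i)) (sym parity-i+h))
      from : ∀ {y} → y % (2 * h) ≡ (i + h) % (2 * h) → y % h ≡ i % h × ¬ y % (2 * h) ≡ i % (2 * h)
      from {y} y≡i+h with ≡-mod-2*⇒ y≡i+h
      ... | y≡i , parity-y = trans y≡i i+h≡i , λ y≡i′ →
        suc-%2-≢ (i / h) (trans (sym (trans parity-y parity-i+h)) (proj₂ (≡-mod-2*⇒ y≡i′)))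

  [1+h]*m%[2*h]≡[m+h]%[2*h] : ∀ {y} → Odd y → ((1 + h) * y) % (2 * h) ≡ (y + h) % (2 * h)
  [1+h]*m%[2*h]≡[m+h]%[2*h] {y} odd-y = begin
    ((1 + h) * y) % (2 * h)                           ≡⟨ cong (λ r → ((1 + h) * r) % (2 * h)) y≡1+2q ⟩
    ((1 + h) * (1 + q * 2)) % (2 * h)                 ≡⟨ cong (_% (2 * h)) (expand h q) ⟩
    (1 + q * 2 + h + q * (2 * h)) % (2 * h)           ≡⟨ [m+kn]%n≡m%n (1 + q * 2 + h) q (2 * h) ⟩
    (1 + q * 2 + h) % (2 * h)                         ≡⟨ cong (λ r → (r + h) % (2 * h)) y≡1+2q ⟨
    (y + h) % (2 * h)                                 ∎
    where
    q : ℕ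
    q = y / 2
    y≡1+2q : y ≡ 1 + q * 2
    y≡1+2q = trans (m≡m%n+[m/n]*n y 2) (cong (_+ q * 2) odd-y)
    expand : ∀ h q → (1 + h) * (1 + q * 2) ≡ 1 + q * 2 + h + q * (2 * h)
    expand = solve-∀

  [m+h+h]%[2*h]≡m%[2*h] : ∀ y → (y + h + h) % (2 * h) ≡ y % (2 * h)
  [m+h+h]%[2*h]≡m%[2*h] y = begin
    (y + h + h) % (2 * h)  ≡⟨ cong (_% (2 * h)) (trans (+-assoc y h h) (cong (λ r → y + (h + r)) (sym (+-identityʳ h)))) ⟩
    (y + 2 * h) % (2 * h)  ≡⟨ [m+n]%n≡m%n y (2 * h) ⟩
    y % (2 * h)            ∎

  countMod-map-[1+h]* : ∀ i {xs} → All Odd xs →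
                        countMod (2 * h) i (map ((1 + h) *_) xs) ≡ countMod (2 * h) (i + h) xs
  countMod-map-[1+h]* i odds = count-map _ _ ((1 + h) *_) (All.map (λ odd-y → mk⇔ (to odd-y) (from odd-y)) odds)
    where
    to : ∀ {y} → Odd y → ((1 + h) * y) % (2 * h) ≡ i % (2 * h) → y % (2 * h) ≡ (i + h) % (2 * h)
    to {y} odd-y [1+h]y≡i = begin
      y % (2 * h)             ≡⟨ [m+h+h]%[2*h]≡m%[2*h] y ⟨
      (y + h + h) % (2 * h)   ≡⟨ %-cong-+ʳ {2 * h} h (trans (sym ([1+h]*m%[2*h]≡[m+h]%[2*h] odd-y)) [1+h]y≡i) ⟩
      (i + h) % (2 * h)       ∎
    from : ∀ {y} → Odd y → y % (2 * h) ≡ (i + h) % (2 * h) → ((1 + h) * y) % (2 * h) ≡ i % (2 * h)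
    from {y} odd-y y≡i+h = begin
      ((1 + h) * y) % (2 * h) ≡⟨ [1+h]*m%[2*h]≡[m+h]%[2*h] odd-y ⟩
      (y + h) % (2 * h)       ≡⟨ %-cong-+ʳ {2 * h} h y≡i+h ⟩
      (i + h + h) % (2 * h)   ≡⟨ [m+h+h]%[2*h]≡m%[2*h] i ⟩
      i % (2 * h)             ∎

  countMod-doubled : ∀ i {xs} → All Odd xs →
                     countMod (2 * h) i (xs ++ map ((1 + h) *_) xs) ≡ countMod h i xs
  countMod-doubled i {xs} odds = begin
    countMod (2 * h) i (xs ++ map ((1 + h) *_) xs)                  ≡⟨ count-++ _ xs _ ⟩
    countMod (2 * h) i xs + countMod (2 * h) i (map ((1 + h) *_) xs) ≡⟨ cong (countMod (2 * h) i xs +_) (countMod-map-[1+h]* i odds) ⟩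
    countMod (2 * h) i xs + countMod (2 * h) (i + h) xs              ≡⟨ countMod-split i xs ⟨
    countMod h i xs                                                  ∎

  equidistributed-double : ∀ {xs} → All Odd xs → Equidistributed h xs →
                           Equidistributed (2 * h) (xs ++ map ((1 + h) *_) xs)
  equidistributed-double odds eq i j odd-i odd-j =
    trans (countMod-doubled i odds) (trans (eq i j odd-i odd-j) (sym (countMod-doubled j odds)))

Π-suc-odd : ∀ n → Odd (suc n) → Π (suc n) ≡ Π n ++ map (suc n *_) (Π n)
Π-suc-odd n odd = cong (if_then Π n ++ map (suc n *_) (Π n) else Π n) (dec-true (suc n % 2 ≟ 1) odd)

Π-suc-even : ∀ n → ¬ Odd (suc n) → Π (suc n) ≡ Π n
Π-suc-even n even = cong (if_then Π n ++ map (suc n *_) (Π n) else Π n) (dec-false (suc n % 2 ≟ 1) even)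

all-odd-Π : ∀ n → All Odd (Π n)
all-odd-Π zero = refl ∷ []
all-odd-Π (suc n) with suc n % 2 ≟ 1
... | yes odd rewrite Π-suc-odd n odd = ++⁺ (all-odd-Π n) (map⁺ (All.map (λ {y} → odd-* {suc n} {y} odd) (all-odd-Π n)))
... | no even rewrite Π-suc-even n even = all-odd-Π n

module _ (k : ℕ) where

  private instance
    2^[1+k]≢0 : NonZero (2 ^ suc k)
    2^[1+k]≢0 = m^n≢0 2 (suc k)

  odd⇒invertible-mod-2^ : ∀ {x} → Odd x → ∃[ y ] Odd y × (x * y) % 2 ^ suc k ≡ 1 % 2 ^ suc k
  odd⇒invertible-mod-2^ {x} odd-x =
    let y , xy≡1 = coprime⇒invertible (odd⇒coprime-2^ {x} odd-x (suc k))
    in y , odd-*⇒oddʳ {x} (%-cong-∣ {2 ^ suc k} {2} {x * y} {1} (m∣m*n (2 ^ k)) xy≡1) , xy≡1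

  equidistributed-Π-suc : ∀ n → Equidistributed (2 ^ suc k) (Π n) → Equidistributed (2 ^ suc k) (Π (suc n))
  equidistributed-Π-suc n eq with suc n % 2 ≟ 1
  ... | no even rewrite Π-suc-even n even = eq
  ... | yes odd rewrite Π-suc-odd n odd with odd⇒invertible-mod-2^ {suc n} odd
  ...   | y , odd-y , xy≡1 =
    equidistributed-++ {2 ^ suc k} {Π n} eq (equidistributed-map-* {2 ^ suc k} {suc n} {y} {Π n} xy≡1 odd-y eq)

  equidistributed-Π-mono : ∀ {n n′} → n ≤ n′ → Equidistributed (2 ^ suc k) (Π n) → Equidistributed (2 ^ suc k) (Π n′)
  equidistributed-Π-mono n≤n′ = go (≤⇒≤′ n≤n′)
    where
    go : ∀ {n n′} → n ≤′ n′ → Equidistributed (2 ^ suc k) (Π n) → Equidistributed (2 ^ suc k) (Π n′)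
    go ≤′-refl = id
    go (≤′-step {n′} n≤n′) = equidistributed-Π-suc n′ ∘ go n≤n′

1+2^k≤2^[1+k] : ∀ k → suc (2 ^ k) ≤ 2 ^ suc k
1+2^k≤2^[1+k] k = subst (_≤ 2 ^ suc k) (+-comm (2 ^ k) 1) (+-monoʳ-≤ (2 ^ k) (m≤n⇒m≤n+o 0 (m^n>0 2 k)))

odd-1+2^[1+k] : ∀ k → Odd (suc (2 ^ suc k))
odd-1+2^[1+k] k = %-remove-+ʳ 1 {d = 2} (m∣m*n (2 ^ k))

equidistributed-Π : ∀ k → Equidistributed (2 ^ suc k) {{m^n≢0 2 (suc k)}} (Π (suc (2 ^ k)))
equidistributed-Π zero = equidistributed-mod-2 (Π 2)
equidistributed-Π (suc k) rewrite Π-suc-odd (2 ^ suc k) (odd-1+2^[1+k] k) =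
  equidistributed-double {2 ^ suc k} (all-odd-Π (2 ^ suc k))
    (equidistributed-Π-mono k (1+2^k≤2^[1+k] k) (equidistributed-Π k))
  where
  instance
    2^[1+k]≢0 : NonZero (2 ^ suc k)
    2^[1+k]≢0 = m^n≢0 2 (suc k)

mainTheorem9 : (n k : ℕ) → 1 ≤ n → 1 ≤ k → 2 ^ (k Data.Nat.∸ 1) + 2 ≤ n → (i j : ℕ) → i < 2 ^ k → j < 2 ^ k → i % 2 ≡ 1 → j % 2 ≡ 1 → m n k i ≡ m n k j
mainTheorem9 n zero _ () _
mainTheorem9 n (suc k) _ _ 2^k+2≤n i j _ _ =
  equidistributed-Π-mono k (≤-trans 1+2^k≤2^k+2 2^k+2≤n) (equidistributed-Π k) i j
  where
  1+2^k≤2^k+2 : suc (2 ^ k) ≤ 2 ^ k + 2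
  1+2^k≤2^k+2 = subst (_≤ 2 ^ k + 2) (+-comm (2 ^ k) 1) (+-monoʳ-≤ (2 ^ k) (n≤1+n 1))
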